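{- Let $G=K_S(r,s)$ be a complete split graph without isolated vertices, where $r$ is the order of its clique and $s$ the order of its independent set. Then $\varphi(G^2)=\frac{1}{2}(r+s-1)(r+s-2)$.
   Context: All graphs are simple and finite. A split graph is a graph whose vertex set can be partitioned into a clique $K_r$ and an independent set $S$; it is a complete split graph, denoted $K_S(r,s)$ with $r=|V(K_r)|$, $s=|S|$, if every vertex of $S$ is adjacent to every vertex of $K_r$. $\mathbb{N}_0$ denotes the set of non-negative integers. For non-empty $A,B\subseteq\mathbb{N}_0$, $A+B=\{a+b: a\in A, b\in B\}$. An integer additive set-indexer (IASI) of a graph $G$ is an injective function $f:V(G)\to\mathcal{P}(\mathbb{N}_0)$ with non-empty values such that the induced map $f^+(uv)=f(u)+f(v)$ on $E(G)$ is also injective. An IASI is weak if $|f^+(uv)|=\max(|f(u)|,|f(v)|)$ for every edge $uv$. An element (vertex or edge) is mono-indexed if its set-label has cardinality $1$. The sparing number $\varphi(H)$ of a graph $H$ is the minimum number of mono-indexed edges over all weak IASIs of $H$. The square $G^2$ of $G$ has vertex set $V(G)$, two distinct vertices adjacent iff their distance in $G$ is at most $2$. -}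

module Defs where

open import Data.Nat using (ℕ; zero; suc; _+_; _*_; _∸_; _≤_; _<_; _⊔_; _<?_; _≟_)
open import Data.Nat.DivMod using (_/_)
open import Data.Fin using (Fin; toℕ)
import Data.Fin as F
open import Data.Bool using (Bool; true; false; _∧_; _∨_; not; if_then_else_)
open import Data.List using (List; []; _∷_; [_]; length; map; concatMap; allFin; deduplicate)
open import Data.Bool.ListAction using (any)
open import Data.Nat.ListAction using (sum)
open import Data.List.Membership.Propositional using (_∈_)
open import Data.Product using (Σ; ∃; _×_; _,_)
open import Relation.Nullary using (¬_)
open import Relation.Nullary.Decidable using (⌊_⌋)
open import Relation.Binary.PropositionalEquality using (_≡_; _≢_)

-- Finite subsets of ℕ₀, represented by lists (set semantics: membership).

FinSet : Set
FinSet = List ℕ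

_≐_ : FinSet → FinSet → Set
A ≐ B = ∀ x → (x ∈ A → x ∈ B) × (x ∈ B → x ∈ A)

card : FinSet → ℕ
card A = length (deduplicate _≟_ A)

_⊕_ : FinSet → FinSet → FinSet
A ⊕ B = concatMap (λ a → map (a +_) B) A

-- Simple graphs on vertex set Fin n, given by a Boolean adjacency
-- function (the graphs constructed below are symmetric and irreflexive).

Graph : ℕ → Set
Graph n = Fin n → Fin n → Bool

_≠ᵇ_ : ∀ {n} → Fin n → Fin n → Bool
i ≠ᵇ j = not ⌊ i F.≟ j ⌋

-- complete split graph K_S(r,s): vertices with index < r form the clique K_r,
-- the other s vertices form the independent set S, every vertex of S is
-- adjacent to every vertex of K_r.
completeSplit : (r s : ℕ) → Graph (r + s)
completeSplit r s i j = (i ≠ᵇ j) ∧ (⌊ toℕ i <? r ⌋ ∨ ⌊ toℕ j <? r ⌋)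

square : ∀ {n} → Graph n → Graph n
square {n} G i j = (i ≠ᵇ j) ∧ (G i j ∨ any (λ k → G i k ∧ G k j) (allFin n))

NoIsolatedVertices : ∀ {n} → Graph n → Set
NoIsolatedVertices {n} G = ∀ (v : Fin n) → ∃ λ u → G u v ≡ true

edgeSlots : (n : ℕ) → List (Fin n × Fin n)
edgeSlots n = concatMap (λ i → concatMap (λ j →
  if ⌊ toℕ i <? toℕ j ⌋ then [ (i , j) ] else []) (allFin n)) (allFin n)

record IsIASI {n} (G : Graph n) (f : Fin n → FinSet) : Set where
  field
    nonempty     : ∀ v → f v ≢ []
    injective    : ∀ u v → f u ≐ f v → u ≡ v
    edgeInjective : ∀ i j k l → toℕ i < toℕ j → toℕ k < toℕ l →
                    G i j ≡ true → G k l ≡ true →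
                    (f i ⊕ f j) ≐ (f k ⊕ f l) → (i ≡ k × j ≡ l)

record IsWeakIASI {n} (G : Graph n) (f : Fin n → FinSet) : Set where
  field
    iasi : IsIASI G f
    weak : ∀ u v → G u v ≡ true → card (f u ⊕ f v) ≡ card (f u) ⊔ card (f v)

monoEdges : ∀ {n} → Graph n → (Fin n → FinSet) → ℕ
monoEdges {n} G f = sum (map (λ { (i , j) →
  if G i j ∧ ⌊ card (f i ⊕ f j) ≟ 1 ⌋ then 1 else 0 }) (edgeSlots n))

SparingNumber : ∀ {n} → Graph n → ℕ → Set
SparingNumber {n} G m =
  (Σ (Fin n → FinSet) λ f → IsWeakIASI G f × monoEdges G f ≡ m) ×
  (∀ f → IsWeakIASI G f → m ≤ monoEdges G f)

-- Let G = K_S(r,s) have no isolated vertices and put n = r + s.  Then the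
-- clique is non-empty, any clique vertex is adjacent to every other vertex,
-- hence any two vertices are at distance at most 2 and G² is the complete
-- graph on n vertices.  The theorem is therefore an instance of
--
--   φ(K_n) = C(n-1, 2) = (n-1)(n-2)/2,
--
-- which we prove for every irreflexive complete graph on Fin n.
--  * Lower bound.  If |A| ≥ 2 and |B| ≥ 2 then |A + B| > max(|A|, |B|), so
--    under a weak IASI no edge has two endpoints with non-singleton labels.
--    In a complete graph at most one vertex is therefore not mono-indexed,
--    and each of the ≥ C(n-1,2) pairs of mono-indexed vertices spans a
--    mono-indexed edge.
--  * Upper bound.  Label vertex 0 by {0,1} and vertex k ≥ 1 by {2^k}.  Sums
--    of two distinct powers of two are distinct, so this is a weak IASI, and
--    its mono-indexed edges all avoid vertex 0: there are at most C(n-1,2).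

module Submission where

open import Defs
open import Data.Nat using (ℕ; zero; suc; _+_; _*_; _∸_; _^_; _≤_; _<_; _⊔_; _<ᵇ_; _≡ᵇ_; _≟_; _<?_; z≤n; s≤s)
open import Data.Nat.Properties
  using ( ≤-refl; ≤-reflexive; ≤-trans; ≤-antisym; <-irrefl; <-cmp; ≤∧≢⇒<; <⇒≢; n<1+n; n≤1+n
        ; 0≢1+n; <ᵇ⇒<; ≡ᵇ⇒≡; +-comm; +-identityʳ; +-cancelˡ-≡; +-cancelʳ-≡; +-mono-≤; +-mono-≤-<
        ; +-monoˡ-<; m≤n+m; m≤n+m∸n; ∸-+-assoc; *-comm; *-distribˡ-+; *-distribʳ-+; ⊔-lub
        ; ^-monoʳ-≤; ^-monoʳ-<; module ≤-Reasoning )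
open import Data.Nat.DivMod using (_/_; m*n/n≡m)
open import Data.Nat.ListAction using (sum)
open import Data.Nat.ListAction.Properties using (sum-++)
open import Data.Fin using (Fin; toℕ; zero; suc)
import Data.Fin as Fin
open import Data.Fin.Properties using (toℕ-injective; suc-injective)
open import Data.Bool using (Bool; true; false; T; _∧_; if_then_else_)
open import Data.Bool.Properties using (T-≡; T-∧; T-∨)
open import Data.Unit using (tt)
open import Data.Empty using (⊥; ⊥-elim)
open import Data.Product using (∃₂; _×_; _,_; proj₁; proj₂)
open import Data.Sum using (_⊎_; inj₁; inj₂)
import Data.Sum as Sum
open import Data.Bool.ListAction using (any)
open import Data.List using (List; []; _∷_; [_]; _++_; length; map; concatMap; allFin; tabulate; deduplicate)
open import Data.List.Properties using (map-++; length-map)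
open import Data.List.Extrema.Nat using (max; ⊥≤max; xs≤max; argmax-sel)
open import Data.List.Membership.Propositional using (_∈_; lose)
open import Data.List.Membership.Propositional.Properties
  using (∈-map⁺; ∈-map⁻; ∈-++⁺ˡ; ∈-++⁺ʳ; ∈-deduplicate⁺; ∈-deduplicate⁻; ∈-allFin)
open import Data.List.Relation.Unary.Any using (here; there)
open import Data.List.Relation.Unary.Any.Properties using (any⁺; singleton⁻)
import Data.List.Relation.Unary.All as All
open import Data.List.Relation.Unary.AllPairs using (_∷_)
open import Data.List.Relation.Unary.Unique.Propositional using (Unique)
open import Data.List.Relation.Unary.Unique.Propositional.Properties using (map⁺)
open import Data.List.Relation.Unary.Unique.DecPropositional.Properties using (deduplicate-!)
open import Function using (_∘_; id; Equivalence)
open import Relation.Binary.Definitions using (tri<; tri≈; tri>)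
open import Relation.Binary.PropositionalEquality
  using (_≡_; _≢_; refl; sym; trans; cong; cong₂; subst; module ≡-Reasoning)
open import Relation.Nullary using (¬_; yes; no)
open import Relation.Nullary.Decidable using (⌊_⌋; isYes≗does; toWitness; fromWitness)

open Equivalence using (to; from)

-- Counting over vertices and over pairs of vertices.

sumFin : ∀ n → (Fin n → ℕ) → ℕ
sumFin zero    g = 0
sumFin (suc n) g = g zero + sumFin n (g ∘ suc)

sumFin-cong : ∀ n {g h : Fin n → ℕ} → (∀ i → g i ≡ h i) → sumFin n g ≡ sumFin n h
sumFin-cong zero    eq = refl
sumFin-cong (suc n) eq = cong₂ _+_ (eq zero) (sumFin-cong n (eq ∘ suc))

sumFin-mono : ∀ n {g h : Fin n → ℕ} → (∀ i → g i ≤ h i) → sumFin n g ≤ sumFin n h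
sumFin-mono zero    le = z≤n
sumFin-mono (suc n) le = +-mono-≤ (le zero) (sumFin-mono n (le ∘ suc))

sumFin-zero : ∀ n → sumFin n (λ _ → 0) ≡ 0
sumFin-zero zero    = refl
sumFin-zero (suc n) = sumFin-zero n

sum-map-tabulate : ∀ {A : Set} n (g : Fin n → A) (h : A → ℕ) →
                   sum (map h (tabulate g)) ≡ sumFin n (h ∘ g)
sum-map-tabulate zero    g h = refl
sum-map-tabulate (suc n) g h = cong (h (g zero) +_) (sum-map-tabulate n (g ∘ suc) h)

sum-map-concatMap : ∀ {A B : Set} (F : A → List B) (h : B → ℕ) xs →
                    sum (map h (concatMap F xs)) ≡ sum (map (λ x → sum (map h (F x))) xs)
sum-map-concatMap F h []       = refl
sum-map-concatMap F h (x ∷ xs) = begin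
  sum (map h (F x ++ concatMap F xs))                 ≡⟨ cong sum (map-++ h (F x) (concatMap F xs)) ⟩
  sum (map h (F x) ++ map h (concatMap F xs))         ≡⟨ sum-++ (map h (F x)) _ ⟩
  sum (map h (F x)) + sum (map h (concatMap F xs))    ≡⟨ cong (sum (map h (F x)) +_) (sum-map-concatMap F h xs) ⟩
  sum (map h (F x)) + sum (map (λ y → sum (map h (F y))) xs) ∎
  where open ≡-Reasoning

indicator : Bool → ℕ
indicator b = if b then 1 else 0

indicator-mono : ∀ {a b} → (T a → T b) → indicator a ≤ indicator b
indicator-mono {false}         _   = z≤n
indicator-mono {true}  {true}  _   = ≤-refl
indicator-mono {true}  {false} a⇒b = ⊥-elim (a⇒b tt)

count : ∀ n → (Fin n → Bool) → ℕ
count n p = sumFin n (indicator ∘ p)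

pairSum : ∀ n → (Fin n → Fin n → ℕ) → ℕ
pairSum n h = sumFin n λ i → sumFin n λ j → if toℕ i <ᵇ toℕ j then h i j else 0

pairSum-mono : ∀ n {h h′ : Fin n → Fin n → ℕ} →
               (∀ i j → toℕ i < toℕ j → h i j ≤ h′ i j) → pairSum n h ≤ pairSum n h′
pairSum-mono n {h} {h′} le = sumFin-mono n λ i → sumFin-mono n λ j → guarded i j
  where
  guarded : ∀ i j → (if toℕ i <ᵇ toℕ j then h i j else 0) ≤ (if toℕ i <ᵇ toℕ j then h′ i j else 0)
  guarded i j with toℕ i <ᵇ toℕ j in i<ᵇj
  ... | true  = le i j (<ᵇ⇒< _ _ (from T-≡ i<ᵇj))
  ... | false = z≤n

sum-edgeSlots : ∀ n (H : Fin n × Fin n → ℕ) →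
                sum (map H (edgeSlots n)) ≡ pairSum n (λ i j → H (i , j))
sum-edgeSlots n H = begin
  sum (map H (edgeSlots n))                     ≡⟨ sum-map-concatMap _ H (allFin n) ⟩
  sum (map (λ i → sum (map H (row i))) (allFin n)) ≡⟨ sum-map-tabulate n id _ ⟩
  sumFin n (λ i → sum (map H (row i)))          ≡⟨ sumFin-cong n rowSum ⟩
  pairSum n (λ i j → H (i , j))                 ∎
  where
  open ≡-Reasoning
  slots : Fin n → Fin n → List (Fin n × Fin n)
  slots i j = if ⌊ toℕ i <? toℕ j ⌋ then [ (i , j) ] else []
  row : Fin n → List (Fin n × Fin n)
  row i = concatMap (slots i) (allFin n)
  slot : ∀ i j → sum (map H (slots i j)) ≡ (if toℕ i <ᵇ toℕ j then H (i , j) else 0)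
  slot i j rewrite isYes≗does (toℕ i <? toℕ j) with toℕ i <ᵇ toℕ j
  ... | true  = +-identityʳ _
  ... | false = refl
  rowSum : ∀ i → sum (map H (row i)) ≡ sumFin n (λ j → if toℕ i <ᵇ toℕ j then H (i , j) else 0)
  rowSum i = trans (sum-map-concatMap (slots i) H (allFin n))
                   (trans (sum-map-tabulate n id _) (sumFin-cong n (slot i)))

choose2 : ℕ → ℕ
choose2 zero    = 0
choose2 (suc t) = t + choose2 t

choose2-mono : ∀ {a b} → a ≤ b → choose2 a ≤ choose2 b
choose2-mono {zero}          _         = z≤n
choose2-mono {suc a} {suc b} (s≤s a≤b) = +-mono-≤ a≤b (choose2-mono a≤b)

choose2-double : ∀ t → choose2 t * 2 ≡ t * (t ∸ 1)
choose2-double zero          = refl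
choose2-double (suc zero)    = refl
choose2-double (suc (suc u)) = begin
  (suc u + choose2 (suc u)) * 2     ≡⟨ *-distribʳ-+ 2 (suc u) (choose2 (suc u)) ⟩
  suc u * 2 + choose2 (suc u) * 2   ≡⟨ cong (suc u * 2 +_) (choose2-double (suc u)) ⟩
  suc u * 2 + suc u * u             ≡⟨ sym (*-distribˡ-+ (suc u) 2 u) ⟩
  suc u * (2 + u)                   ≡⟨ *-comm (suc u) (2 + u) ⟩
  suc (suc u) * suc u               ∎
  where open ≡-Reasoning

choose2-pred : ∀ n → choose2 (n ∸ 1) ≡ ((n ∸ 1) * (n ∸ 2)) / 2
choose2-pred n = begin
  choose2 (n ∸ 1)               ≡⟨ sym (m*n/n≡m (choose2 (n ∸ 1)) 2) ⟩
  choose2 (n ∸ 1) * 2 / 2       ≡⟨ cong (_/ 2) (choose2-double (n ∸ 1)) ⟩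
  (n ∸ 1) * (n ∸ 1 ∸ 1) / 2     ≡⟨ cong (λ x → (n ∸ 1) * x / 2) (∸-+-assoc n 1 1) ⟩
  (n ∸ 1) * (n ∸ 2) / 2         ∎
  where open ≡-Reasoning

-- By
-- definition pairSum (suc n) h splits into the pairs through vertex 0 and
-- the pairs among the remaining n vertices, which gives the induction.
pairSum-both : ∀ n p → pairSum n (λ i j → indicator (p i ∧ p j)) ≡ choose2 (count n p)
pairSum-both zero    p = refl
pairSum-both (suc n) p with p zero
... | true  = cong (count n (p ∘ suc) +_) (pairSum-both n (p ∘ suc))
... | false = cong₂ _+_ (sumFin-zero n) (pairSum-both n (p ∘ suc))

count-all : ∀ n p → (∀ i → p i ≡ true) → count n p ≡ n
count-all zero    p all = refl
count-all (suc n) p all rewrite all zero = cong suc (count-all n (p ∘ suc) (all ∘ suc))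

count-atMostOneFails : ∀ n p → (∀ u v → p u ≡ false → p v ≡ false → u ≡ v) →
                       n ∸ 1 ≤ count n p
count-atMostOneFails zero    p unique = z≤n
count-atMostOneFails (suc n) p unique with p zero in p0
... | true  = ≤-trans (m≤n+m∸n n 1) (s≤s (count-atMostOneFails n (p ∘ suc) uniqueSuc))
  where
  uniqueSuc : ∀ u v → p (suc u) ≡ false → p (suc v) ≡ false → u ≡ v
  uniqueSuc u v pu pv = suc-injective (unique (suc u) (suc v) pu pv)
... | false = ≤-reflexive (sym (count-all n (p ∘ suc) othersHold))
  where
  othersHold : ∀ i → p (suc i) ≡ true
  othersHold i with p (suc i) in pi
  ... | true  = refl
  ... | false with unique zero (suc i) p0 pi
  ...   | ()

-- Cardinalities of sumsets.

∈-⊕ : ∀ {a b A B} → a ∈ A → b ∈ B → a + b ∈ A ⊕ B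
∈-⊕         (here refl) b∈B = ∈-++⁺ˡ (∈-map⁺ (_ +_) b∈B)
∈-⊕ {A = a ∷ A} {B} (there a∈A) b∈B = ∈-++⁺ʳ (map (a +_) B) (∈-⊕ a∈A b∈B)

remove : ∀ {x : ℕ} {V} → x ∈ V → List ℕ
remove {V = _ ∷ V} (here _)  = V
remove {V = y ∷ V} (there p) = y ∷ remove p

length-remove : ∀ {x : ℕ} {V} (p : x ∈ V) → length V ≡ suc (length (remove p))
length-remove (here _)  = refl
length-remove (there p) = cong suc (length-remove p)

∈-remove : ∀ {x z : ℕ} {V} (p : x ∈ V) → z ∈ V → z ≢ x → z ∈ remove p
∈-remove (here refl) (here refl) z≢x = ⊥-elim (z≢x refl)
∈-remove (here refl) (there z∈V) z≢x = z∈V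
∈-remove (there p)   (here z≡y)  z≢x = here z≡y
∈-remove (there p)   (there z∈V) z≢x = there (∈-remove p z∈V z≢x)

Unique-⊆-length : ∀ {U V : List ℕ} → Unique U → (∀ {x} → x ∈ U → x ∈ V) → length U ≤ length V
Unique-⊆-length {[]}    _             _   = z≤n
Unique-⊆-length {x ∷ U} {V} (x∉U ∷ uniqU) U⊆V = begin
  suc (length U)                 ≤⟨ s≤s (Unique-⊆-length uniqU U⊆rest) ⟩
  suc (length (remove x∈V))      ≡⟨ sym (length-remove x∈V) ⟩
  length V                       ∎
  where
  open ≤-Reasoning
  x∈V : x ∈ V
  x∈V = U⊆V (here refl)
  U⊆rest : ∀ {z} → z ∈ U → z ∈ remove x∈V
  U⊆rest z∈U = ∈-remove x∈V (U⊆V (there z∈U)) (λ z≡x → All.lookup x∉U z∈U (sym z≡x))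

card-≥ : ∀ {U C} → Unique U → (∀ {x} → x ∈ U → x ∈ C) → length U ≤ card C
card-≥ uniqU U⊆C = Unique-⊆-length uniqU (∈-deduplicate⁺ _≟_ ∘ U⊆C)

card-pos : ∀ A → A ≢ [] → 1 ≤ card A
card-pos []      A≢[] = ⊥-elim (A≢[] refl)
card-pos (x ∷ A) _    = s≤s z≤n

two-elements : ∀ A → 2 ≤ card A → ∃₂ λ x y → x ∈ A × y ∈ A × x < y
two-elements A 2≤card = orderPair (deduplicate _≟_ A) (deduplicate-! _≟_ A) 2≤card (∈-deduplicate⁻ _≟_ A)
  where
  orderPair : ∀ L → Unique L → 2 ≤ length L → (∀ {x} → x ∈ L → x ∈ A) →
              ∃₂ λ x y → x ∈ A × y ∈ A × x < y
  orderPair (x ∷ [])    _          (s≤s ()) _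
  orderPair (x ∷ y ∷ L) (x∉ ∷ _) _        L⊆A with <-cmp x y
  ... | tri< x<y _ _ = x , y , L⊆A (here refl) , L⊆A (there (here refl)) , x<y
  ... | tri≈ _ x≡y _ = ⊥-elim (All.lookup x∉ (here refl) x≡y)
  ... | tri> _ _ y<x = y , x , L⊆A (there (here refl)) , L⊆A (here refl) , y<x

max-∈ : ∀ a A → max a A ∈ a ∷ A
max-∈ a A with argmax-sel id a A
... | inj₁ max≡a  = here max≡a
... | inj₂ max∈A = there max∈A

≤-max : ∀ {x a A} → x ∈ a ∷ A → x ≤ max a A
≤-max {a = a} {A} (here refl)  = ⊥≤max a A
≤-max {a = a} {A} (there x∈A) = All.lookup (xs≤max a A) x∈A

-- Adding to A a set with two elements b₁ < b₂ yields more than |A| sums: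
-- the |A| sums a + b₁ are distinct and all below max A + b₂.
card-sumset-grows : ∀ {A B C b₁ b₂} → A ≢ [] → b₁ ∈ B → b₂ ∈ B → b₁ < b₂ →
                    (∀ {a b} → a ∈ A → b ∈ B → a + b ∈ C) → card A < card C
card-sumset-grows {[]}    A≢[] _ _ _ _ = ⊥-elim (A≢[] refl)
card-sumset-grows {a ∷ A} {B} {C} {b₁} {b₂} _ b₁∈B b₂∈B b₁<b₂ A+B⊆C = begin-strict
  card (a ∷ A)                        ≡⟨ sym (length-map (_+ b₁) (deduplicate _≟_ (a ∷ A))) ⟩
  length (map (_+ b₁) dedupA)         <⟨ n<1+n _ ⟩
  length sums                         ≤⟨ card-≥ sums-unique sums⊆C ⟩
  card C                              ∎
  where
  open ≤-Reasoning
  dedupA : List ℕ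
  dedupA = deduplicate _≟_ (a ∷ A)
  top : ℕ
  top = max a A
  sums : List ℕ
  sums = (top + b₂) ∷ map (_+ b₁) dedupA
  fromDedup : ∀ {x} → x ∈ dedupA → x ∈ a ∷ A
  fromDedup = ∈-deduplicate⁻ _≟_ (a ∷ A)
  top-new : All.All (top + b₂ ≢_) (map (_+ b₁) dedupA)
  top-new = All.tabulate exceeds
    where
    exceeds : ∀ {y} → y ∈ map (_+ b₁) dedupA → top + b₂ ≢ y
    exceeds y∈ eq with ∈-map⁻ (_+ b₁) y∈
    ... | x , x∈ , refl = <-irrefl (sym eq) (+-mono-≤-< (≤-max (fromDedup x∈)) b₁<b₂)
  sums-unique : Unique sums
  sums-unique = top-new ∷ map⁺ (+-cancelʳ-≡ b₁ _ _) (deduplicate-! _≟_ (a ∷ A))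
  sums⊆C : ∀ {x} → x ∈ sums → x ∈ C
  sums⊆C (here refl) = A+B⊆C (max-∈ a A) b₂∈B
  sums⊆C (there x∈) with ∈-map⁻ (_+ b₁) x∈
  ... | y , y∈ , refl = A+B⊆C (fromDedup y∈) b₁∈B

card-⊕-exceeds : ∀ A B → 2 ≤ card A → 2 ≤ card B → card A ⊔ card B < card (A ⊕ B)
card-⊕-exceeds A B 2≤A 2≤B with two-elements A 2≤A | two-elements B 2≤B
... | a₁ , a₂ , a₁∈ , a₂∈ , a₁<a₂ | b₁ , b₂ , b₁∈ , b₂∈ , b₁<b₂ =
  ⊔-lub (card-sumset-grows (nonEmpty A 2≤A) b₁∈ b₂∈ b₁<b₂ ∈-⊕)
        (card-sumset-grows (nonEmpty B 2≤B) a₁∈ a₂∈ a₁<a₂ ∈-⊕-flipped)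
  where
  nonEmpty : ∀ X → 2 ≤ card X → X ≢ []
  nonEmpty [] () refl
  ∈-⊕-flipped : ∀ {b a} → b ∈ B → a ∈ A → b + a ∈ A ⊕ B
  ∈-⊕-flipped {b} {a} b∈ a∈ = subst (_∈ A ⊕ B) (+-comm a b) (∈-⊕ a∈ b∈)

-- Lower bound for weak IASIs of complete graphs.

isMono : FinSet → Bool
isMono A = ⌊ card A ≟ 1 ⌋

Complete : ∀ {n} → Graph n → Set
Complete {n} G = ∀ (i j : Fin n) → i ≢ j → G i j ≡ true

Irreflexive : ∀ {n} → Graph n → Set
Irreflexive {n} G = ∀ (i : Fin n) → G i i ≡ false

module _ {n} {G : Graph n} {f : Fin n → FinSet} (weakIASI : IsWeakIASI G f) where
  open IsWeakIASI weakIASI using (iasi; weak)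
  open IsIASI iasi using (nonempty)

  notMono⇒≥2 : ∀ v → isMono (f v) ≡ false → 2 ≤ card (f v)
  notMono⇒≥2 v notMono with card (f v) ≟ 1 | card-pos (f v) (nonempty v)
  ... | no card≢1 | 1≤card = ≤∧≢⇒< 1≤card (card≢1 ∘ sym)

  no-edge-between-nonMono : ∀ u v → G u v ≡ true → isMono (f u) ≡ false → isMono (f v) ≡ false → ⊥
  no-edge-between-nonMono u v uv u-notMono v-notMono =
    <-irrefl (sym (weak u v uv)) (card-⊕-exceeds (f u) (f v) (notMono⇒≥2 u u-notMono) (notMono⇒≥2 v v-notMono))

  mono-ends⇒mono-edge : ∀ u v → G u v ≡ true → T (isMono (f u) ∧ isMono (f v)) → T (G u v ∧ isMono (f u ⊕ f v))
  mono-ends⇒mono-edge u v uv monoEnds = from T-∧ (from T-≡ uv , fromWitness card≡1)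
    where
    card≡1 : card (f u ⊕ f v) ≡ 1
    card≡1 with to (T-∧ {isMono (f u)}) monoEnds
    ... | mono-u , mono-v = trans (weak u v uv) (cong₂ _⊔_ (toWitness mono-u) (toWitness mono-v))

  lowerBound : Complete G → choose2 (n ∸ 1) ≤ monoEdges G f
  lowerBound complete = begin
    choose2 (n ∸ 1)                                  ≤⟨ choose2-mono (count-atMostOneFails n mono atMostOneNonMono) ⟩
    choose2 (count n mono)                           ≡⟨ sym (pairSum-both n mono) ⟩
    pairSum n (λ i j → indicator (mono i ∧ mono j))  ≤⟨ pairSum-mono n monoPair⇒monoEdge ⟩
    pairSum n (λ i j → indicator (G i j ∧ isMono (f i ⊕ f j))) ≡⟨ sym (sum-edgeSlots n _) ⟩
    monoEdges G f                                    ∎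
    where
    open ≤-Reasoning
    mono : Fin n → Bool
    mono = isMono ∘ f
    atMostOneNonMono : ∀ u v → mono u ≡ false → mono v ≡ false → u ≡ v
    atMostOneNonMono u v u-notMono v-notMono with u Fin.≟ v
    ... | yes u≡v = u≡v
    ... | no  u≢v = ⊥-elim (no-edge-between-nonMono u v (complete u v u≢v) u-notMono v-notMono)
    monoPair⇒monoEdge : ∀ i j → toℕ i < toℕ j →
                        indicator (mono i ∧ mono j) ≤ indicator (G i j ∧ isMono (f i ⊕ f j))
    monoPair⇒monoEdge i j i<j = indicator-mono (mono-ends⇒mono-edge i j (complete i j i≢j))
      where
      i≢j : i ≢ j
      i≢j refl = <-irrefl refl i<j

-- Upper bound: the power-of-two labelling.  First, powers of two.

pow2-mono-< : ∀ {a b} → a < b → 2 ^ a < 2 ^ b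
pow2-mono-< = ^-monoʳ-< 2 (s≤s (s≤s z≤n))

pow2-injective : ∀ {a b} → 2 ^ a ≡ 2 ^ b → a ≡ b
pow2-injective {a} {b} eq with <-cmp a b
... | tri< a<b _ _ = ⊥-elim (<-irrefl eq (pow2-mono-< a<b))
... | tri≈ _ a≡b _ = a≡b
... | tri> _ _ b<a = ⊥-elim (<-irrefl (sym eq) (pow2-mono-< b<a))

pow2-sum-< : ∀ {a b} → a < b → 2 ^ a + 2 ^ b < 2 ^ suc b
pow2-sum-< {a} {b} a<b = begin-strict
  2 ^ a + 2 ^ b         <⟨ +-monoˡ-< (2 ^ b) (pow2-mono-< a<b) ⟩
  2 ^ b + 2 ^ b         ≡⟨ cong (2 ^ b +_) (sym (+-identityʳ (2 ^ b))) ⟩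
  2 ^ suc b             ∎
  where open ≤-Reasoning

pow2-sum-below : ∀ {a b d} c → a < b → b < d → 2 ^ a + 2 ^ b < 2 ^ c + 2 ^ d
pow2-sum-below {a} {b} {d} c a<b b<d = begin-strict
  2 ^ a + 2 ^ b   <⟨ pow2-sum-< a<b ⟩
  2 ^ suc b       ≤⟨ ^-monoʳ-≤ 2 b<d ⟩
  2 ^ d           ≤⟨ m≤n+m (2 ^ d) (2 ^ c) ⟩
  2 ^ c + 2 ^ d   ∎
  where open ≤-Reasoning

pow2-sums-distinct : ∀ {a b c d} → a < b → c < d → 2 ^ a + 2 ^ b ≡ 2 ^ c + 2 ^ d → a ≡ c × b ≡ d
pow2-sums-distinct {a} {b} {c} {d} a<b c<d eq with <-cmp b d
... | tri< b<d _ _  = ⊥-elim (<-irrefl eq (pow2-sum-below c a<b b<d))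
... | tri> _ _ d<b  = ⊥-elim (<-irrefl (sym eq) (pow2-sum-below a c<d d<b))
... | tri≈ _ refl _ = pow2-injective (+-cancelʳ-≡ (2 ^ b) (2 ^ a) (2 ^ c) eq) , refl

label : ℕ → FinSet
label zero    = 0 ∷ 1 ∷ []
label (suc k) = [ 2 ^ suc k ]

label-nonempty : ∀ k → label k ≢ []
label-nonempty zero    ()
label-nonempty (suc k) ()

pow2-≥2 : ∀ k → 2 ≤ 2 ^ suc k
pow2-≥2 k = ^-monoʳ-≤ 2 {1} {suc k} (s≤s z≤n)

n≢1+n : ∀ n → n ≢ suc n
n≢1+n n = <⇒≢ (n<1+n n)

card-pair : ∀ {x y} → x ≢ y → card (x ∷ y ∷ []) ≡ 2
card-pair {x} {y} x≢y with x ≡ᵇ y | ≡ᵇ⇒≡ x y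
... | true  | x≡y = ⊥-elim (x≢y (x≡y tt))
... | false | _   = refl

shifted-pair-injective : ∀ {x y} → (x ∷ suc x ∷ []) ≐ (y ∷ suc y ∷ []) → x ≡ y
shifted-pair-injective {x} {y} eq =
  ≤-antisym (lowest (proj₂ (eq y) (here refl))) (lowest (proj₁ (eq x) (here refl)))
  where
  lowest : ∀ {z w} → z ∈ (w ∷ suc w ∷ []) → w ≤ z
  lowest (here refl)         = ≤-refl
  lowest (there (here refl)) = n≤1+n _

shifted-pair-not-singleton : ∀ {x z} → ¬ ((x ∷ suc x ∷ []) ≐ [ z ])
shifted-pair-not-singleton {x} eq =
  n≢1+n x (trans (singleton⁻ (proj₁ (eq x) (here refl)))
                 (sym (singleton⁻ (proj₁ (eq (suc x)) (there (here refl))))))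

label-injective : ∀ a b → label a ≐ label b → a ≡ b
label-injective zero    zero    _  = refl
label-injective zero    (suc b) eq = ⊥-elim (<-irrefl (singleton⁻ (proj₁ (eq 1) (there (here refl)))) (pow2-≥2 b))
label-injective (suc a) zero    eq = ⊥-elim (<-irrefl (singleton⁻ (proj₂ (eq 1) (there (here refl)))) (pow2-≥2 a))
label-injective (suc a) (suc b) eq = pow2-injective (singleton⁻ (proj₁ (eq (2 ^ suc a)) (here refl)))

label-sums-injective : ∀ {a b c d} → a < b → c < d → (label a ⊕ label b) ≐ (label c ⊕ label d) → a ≡ c × b ≡ d
label-sums-injective {zero}  {suc b} {zero}  {suc d} _ _ eq = refl , pow2-injective (shifted-pair-injective eq)
label-sums-injective {zero}  {suc b} {suc c} {suc d} _ _ eq = ⊥-elim (shifted-pair-not-singleton eq)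
label-sums-injective {suc a} {suc b} {zero}  {suc d} _ _ eq = ⊥-elim (shifted-pair-not-singleton (λ x → swap (eq x)))
  where open Data.Product using (swap)
label-sums-injective {suc a} {suc b} {suc c} {suc d} a<b c<d eq =
  pow2-sums-distinct a<b c<d (singleton⁻ (proj₁ (eq _) (here refl)))

label-weak : ∀ a b → a ≢ b → card (label a ⊕ label b) ≡ card (label a) ⊔ card (label b)
label-weak zero    zero    a≢b = ⊥-elim (a≢b refl)
label-weak zero    (suc b) _   = card-pair {2 ^ suc b} (n≢1+n _)
label-weak (suc a) zero    _   = card-pair {2 ^ suc a + 0} {2 ^ suc a + 1} (0≢1+n ∘ +-cancelˡ-≡ (2 ^ suc a) 0 1)
label-weak (suc a) (suc b) _   = refl

isPositive : ℕ → Bool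
isPositive zero    = false
isPositive (suc _) = true

label-mono-edge : ∀ {a b} → a < b → T (isMono (label a ⊕ label b)) → T (isPositive a ∧ isPositive b)
label-mono-edge {zero}  {suc b} _ mono = ⊥-elim (n≢1+n 1 (trans (sym (toWitness mono)) (card-pair {2 ^ suc b} (n≢1+n _))))
label-mono-edge {suc a} {suc b} _ _    = tt

labelling : ∀ {n} → Fin n → FinSet
labelling v = label (toℕ v)

module _ {n} {G : Graph n} where

  labelling-weakIASI : Irreflexive G → IsWeakIASI G labelling
  labelling-weakIASI irreflexive = record
    { iasi = record
      { nonempty      = label-nonempty ∘ toℕ
      ; injective     = λ u v eq → toℕ-injective (label-injective (toℕ u) (toℕ v) eq)
      ; edgeInjective = λ i j k l i<j k<l _ _ eq →
          let (i≡k , j≡l) = label-sums-injective i<j k<l eq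
          in toℕ-injective i≡k , toℕ-injective j≡l
      }
    ; weak = λ u v uv → label-weak (toℕ u) (toℕ v) (adjacent⇒distinct u v uv ∘ toℕ-injective)
    }
    where
    adjacent⇒distinct : ∀ u v → G u v ≡ true → u ≢ v
    adjacent⇒distinct u .u uu refl with trans (sym (irreflexive u)) uu
    ... | ()

  labelling-monoEdges : monoEdges G labelling ≤ choose2 (n ∸ 1)
  labelling-monoEdges = begin
    monoEdges G labelling                                            ≡⟨ sum-edgeSlots n _ ⟩
    pairSum n (λ i j → indicator (G i j ∧ isMono (labelling i ⊕ labelling j))) ≤⟨ pairSum-mono n monoEdge⇒positive ⟩
    pairSum n (λ i j → indicator (positive i ∧ positive j))          ≡⟨ pairSum-both n positive ⟩
    choose2 (count n positive)                                       ≡⟨ cong choose2 (count-positive n) ⟩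
    choose2 (n ∸ 1)                                                  ∎
    where
    open ≤-Reasoning
    positive : ∀ {m} → Fin m → Bool
    positive = isPositive ∘ toℕ
    monoEdge⇒positive : ∀ i j → toℕ i < toℕ j →
      indicator (G i j ∧ isMono (labelling i ⊕ labelling j)) ≤ indicator (positive i ∧ positive j)
    monoEdge⇒positive i j i<j = indicator-mono (label-mono-edge i<j ∘ proj₂ ∘ to (T-∧ {G i j}))
    count-positive : ∀ m → count m positive ≡ m ∸ 1
    count-positive zero    = refl
    count-positive (suc m) = count-all m (positive ∘ suc) (λ _ → refl)

sparingNumber-complete : ∀ {n} (G : Graph n) → Irreflexive G → Complete G → SparingNumber G (choose2 (n ∸ 1))
sparingNumber-complete G irreflexive complete =
  (labelling , weakLabelling , ≤-antisym (labelling-monoEdges {G = G}) (lowerBound weakLabelling complete)) ,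
  λ f weakIASI → lowerBound weakIASI complete
  where
  weakLabelling : IsWeakIASI G labelling
  weakLabelling = labelling-weakIASI irreflexive

-- The square of a complete split graph without isolated vertices is complete.

≠ᵇ-refl : ∀ {n} (i : Fin n) → (i ≠ᵇ i) ≡ false
≠ᵇ-refl i with i Fin.≟ i
... | yes _   = refl
... | no i≢i = ⊥-elim (i≢i refl)

≠ᵇ-≢ : ∀ {n} {i j : Fin n} → i ≢ j → T (i ≠ᵇ j)
≠ᵇ-≢ {i = i} {j} i≢j with i Fin.≟ j
... | yes i≡j = ⊥-elim (i≢j i≡j)
... | no  _   = tt

square-irreflexive : ∀ {n} (G : Graph n) → Irreflexive (square G)
square-irreflexive G i rewrite ≠ᵇ-refl i = refl

-- If a vertex c is joined to every other vertex, any two vertices are at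
-- distance at most 2 (through c), so the square is complete.
square-complete : ∀ {n} (G : Graph n) (c : Fin n) →
                  (∀ v → v ≢ c → T (G v c) × T (G c v)) → Complete (square G)
square-complete {n} G c central i j i≢j = to T-≡ (from T-∧ (≠ᵇ-≢ i≢j , from T-∨ withinTwo))
  where
  withinTwo : T (G i j) ⊎ T (any (λ k → G i k ∧ G k j) (allFin n))
  withinTwo with i Fin.≟ c | j Fin.≟ c
  ... | yes refl | _        = inj₁ (proj₂ (central j (i≢j ∘ sym)))
  ... | no  _    | yes refl = inj₁ (proj₁ (central i i≢j))
  ... | no  i≢c  | no  j≢c  =
    inj₂ (any⁺ _ (lose (∈-allFin c) (from T-∧ (proj₁ (central i i≢c) , proj₂ (central j j≢c)))))

completeSplit-adj : ∀ r s {i j : Fin (r + s)} → i ≢ j → toℕ i < r ⊎ toℕ j < r → T (completeSplit r s i j)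
completeSplit-adj r s {i} {j} i≢j inClique =
  from (T-∧ {i ≠ᵇ j}) (≠ᵇ-≢ i≢j , from (T-∨ {⌊ toℕ i <? r ⌋}) (Sum.map fromWitness fromWitness inClique))

completeSplit-edge-meets-clique : ∀ r s {u v : Fin (r + s)} → T (completeSplit r s u v) → toℕ u < r ⊎ toℕ v < r
completeSplit-edge-meets-clique r s {u} {v} uv =
  Sum.map toWitness toWitness (to (T-∨ {⌊ toℕ u <? r ⌋}) (proj₂ (to (T-∧ {u ≠ᵇ v}) uv)))

clique-nonempty : ∀ r s → NoIsolatedVertices (completeSplit r s) → Fin (r + s) → 0 < r
clique-nonempty r s noIsolated v with noIsolated v
... | u , uv = Sum.[ positive , positive ]′ (completeSplit-edge-meets-clique r s (from T-≡ uv))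
  where
  positive : ∀ {k} → k < r → 0 < r
  positive k<r = ≤-trans (s≤s z≤n) k<r

square-completeSplit-complete : ∀ r s → NoIsolatedVertices (completeSplit r s) → Complete (square (completeSplit r s))
square-completeSplit-complete zero    s noIsolated i _ _ with clique-nonempty zero s noIsolated i
... | ()
square-completeSplit-complete (suc r) s _ = square-complete (completeSplit (suc r) s) zero central
  where
  central : ∀ v → v ≢ zero → T (completeSplit (suc r) s v zero) × T (completeSplit (suc r) s zero v)
  central v v≢0 = completeSplit-adj (suc r) s v≢0 (inj₂ (s≤s z≤n)) ,
                  completeSplit-adj (suc r) s (v≢0 ∘ sym) (inj₁ (s≤s z≤n))

mainTheorem8 : (r s : ℕ) → NoIsolatedVertices (completeSplit r s) →
    SparingNumber (square (completeSplit r s)) (((r + s ∸ 1) * (r + s ∸ 2)) / 2)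
mainTheorem8 r s noIsolated =
  subst (SparingNumber G²) (choose2-pred (r + s))
    (sparingNumber-complete G² (square-irreflexive G) (square-completeSplit-complete r s noIsolated))
  where
  G G² : Graph (r + s)
  G  = completeSplit r s
  G² = square G
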